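{- Let $n\geq 3$ be an integer. Every wheel $W_n$ of order $n+1$ belongs to Class 1. Hence $\chi_d^t(M(W_n))=4$ if $n$ is even and $\chi_d^t(M(W_n))=5$ if $n$ is odd.
   Context: The wheel $W_n$ is the graph of order $n+1$ obtained from a cycle $C_n$ by adding one vertex adjacent to all vertices of the cycle. A total dominator coloring (TDC) of a graph $G$ is a proper coloring in which every vertex is adjacent to every vertex of some color class; $\chi_d^t(G)$ is the minimum number of color classes in a TDC, and a $\chi_d^t$-coloring is a TDC with $\chi_d^t(G)$ colors. For a TDC $f=(V_1,\dots,V_\ell)$, $v\succ V_i$ means $v$ is adjacent to all vertices of $V_i$; $pn_G(V_i;f)$ is the set of vertices $v$ with $v\succ V_i$ and $v\not\succ V_j$ for all $j\ne i$. $G$ is in Class 1 if some $\chi_d^t$-coloring $f$ has $pn_G(V_i;f)=\emptyset$ for some $i$, and in Class 2 otherwise. If $V(G)=\{v_1,\dots,v_n\}$, the Mycielskian $M(G)$ has vertex set $V(G)\cup\{u_1,\dots,u_n\}\cup\{w\}$ and edge set $E(G)\cup\{u_iv_j : v_iv_j\in E(G)\}\cup\{u_iw : 1\le i\le n\}$. -}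

module Defs where

open import Data.Nat using (ℕ; zero; suc; _≤_; _≡ᵇ_)
open import Data.Fin using (Fin; toℕ)
open import Data.Bool using (Bool; true; false; _∨_; _∧_)
open import Data.Sum using (_⊎_; inj₁; inj₂)
open import Data.Unit using (⊤; tt)
open import Data.Product using (Σ; ∃; _×_; _,_)
open import Relation.Binary.PropositionalEquality using (_≡_; _≢_)

record Graph : Set₁ where
  field
    V   : Set
    adj : V → V → Bool
open Graph public

Edge : (G : Graph) → V G → V G → Set
Edge G u v = adj G u v ≡ true

succMod : (n : ℕ) → Fin n → Fin n → Bool
succMod n i j = (suc (toℕ i) ≡ᵇ toℕ j) ∨ ((suc (toℕ i) ≡ᵇ n) ∧ (toℕ j ≡ᵇ 0))

cycleAdj : (n : ℕ) → Fin n → Fin n → Bool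
cycleAdj n i j = succMod n i j ∨ succMod n j i

wheelAdj : (n : ℕ) → Fin n ⊎ ⊤ → Fin n ⊎ ⊤ → Bool
wheelAdj n (inj₁ i) (inj₁ j) = cycleAdj n i j
wheelAdj n (inj₁ i) (inj₂ _) = true
wheelAdj n (inj₂ _) (inj₁ j) = true
wheelAdj n (inj₂ _) (inj₂ _) = false

Wheel : ℕ → Graph
Wheel n = record { V = Fin n ⊎ ⊤ ; adj = wheelAdj n }

-- Mycielskian: vertices v_i = inj₁ x, u_i = inj₂ (inj₁ x), w = inj₂ (inj₂ tt).
mycAdj : (G : Graph) → V G ⊎ (V G ⊎ ⊤) → V G ⊎ (V G ⊎ ⊤) → Bool
mycAdj G (inj₁ x) (inj₁ y) = adj G x y
mycAdj G (inj₁ x) (inj₂ (inj₁ y)) = adj G y x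
mycAdj G (inj₂ (inj₁ x)) (inj₁ y) = adj G x y
mycAdj G (inj₂ (inj₁ x)) (inj₂ (inj₁ y)) = false
mycAdj G (inj₂ (inj₁ x)) (inj₂ (inj₂ _)) = true
mycAdj G (inj₂ (inj₂ _)) (inj₂ (inj₁ y)) = true
mycAdj G (inj₂ (inj₂ _)) (inj₂ (inj₂ _)) = false
mycAdj G (inj₁ x) (inj₂ (inj₂ _)) = false
mycAdj G (inj₂ (inj₂ _)) (inj₁ y) = false

Mycielskian : Graph → Graph
Mycielskian G = record { V = V G ⊎ (V G ⊎ ⊤) ; adj = mycAdj G }

Coloring : Graph → ℕ → Set
Coloring G k = V G → Fin k

IsProper : (G : Graph) {k : ℕ} → Coloring G k → Set
IsProper G f = ∀ u v → Edge G u v → f u ≢ f v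

AllClassesNonempty : (G : Graph) {k : ℕ} → Coloring G k → Set
AllClassesNonempty G {k} f = (i : Fin k) → ∃ λ v → f v ≡ i

Dom : (G : Graph) {k : ℕ} → Coloring G k → V G → Fin k → Set
Dom G f v i = ∀ u → f u ≡ i → Edge G v u

IsTDC : (G : Graph) (k : ℕ) → Coloring G k → Set
IsTDC G k f = IsProper G f × AllClassesNonempty G f × (∀ v → ∃ λ i → Dom G f v i)

IsChiDT : Graph → ℕ → Set
IsChiDT G k = (∃ λ (f : Coloring G k) → IsTDC G k f)
            × (∀ j (g : Coloring G j) → IsTDC G j g → k ≤ j)

PnEmpty : (G : Graph) {k : ℕ} → Coloring G k → Fin k → Set
PnEmpty G {k} f i = ∀ v → Dom G f v i → ∃ λ (j : Fin k) → j ≢ i × Dom G f v j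

Class1 : Graph → Set
Class1 G = ∃ λ k → IsChiDT G k ×
             (∃ λ (f : Coloring G k) → IsTDC G k f × ∃ λ i → PnEmpty G f i)

-- Colour the cycle of W_n alternately with 0 and 1 (vertex 0 gets a fourth colour
-- when n is odd) and the hub with 2. Every cycle vertex dominates the hub's class and
-- the hub dominates class 1, so class 0 has no private dominators; and the colouring is
-- optimal because the cycle, whose colours must avoid the hub's, is an odd cycle or has
-- an edge. In M(G), give all shadows u_x a new colour and w the colour c of a class
-- without private dominators: every vertex of G dominates a class other than c, and its
-- shadow dominates the same class, so M(G) has a TDC with one more colour. Conversely,
-- recolouring each v_x that shares the colour of w with the colour of u_x turns a proper
-- colouring of M(G) into one of G with a colour to spare.

module Submission where

open import Defs
open import Data.Nat using (ℕ; zero; suc; pred; _+_; _≤_; _<_; _%_; _*_; _≡ᵇ_; s≤s)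
open import Data.Nat.Properties using (≡ᵇ⇒≡; ≡⇒≡ᵇ; ≰⇒>; <⇒≤; n<1+n)
open import Data.Nat.DivMod using (m*n%n≡0; [m+kn]%n≡m%n)
open import Data.Fin using (Fin; zero; suc; toℕ; fromℕ<; inject≤; punchOut; _≟_)
open import Data.Fin.Properties using (toℕ-fromℕ<; inject≤-injective; punchOut-injective; suc-injective)
open import Data.Bool using (T)
open import Data.Bool.Properties using (∨-comm; T-≡; T-∨; T-∧)
open import Data.Sum using (_⊎_; inj₁; inj₂)
import Data.Sum as Sum
open import Data.Product using (∃; _×_; _,_; proj₁)
import Data.Product as Product
open import Data.Unit using (tt)
open import Function using (_∘_; _⇔_; mk⇔; Equivalence)
open import Relation.Nullary using (¬_; yes; no; contradiction)
open import Relation.Binary.PropositionalEquality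
  using (_≡_; _≢_; refl; sym; trans; cong; ≢-sym)

Colourable : Graph → ℕ → Set
Colourable G k = ∃ λ (f : Coloring G k) → IsProper G f

Undirected : Graph → Set
Undirected G = ∀ x y → Edge G x y → Edge G y x

Cycle : ℕ → Graph
Cycle n = record { V = Fin n ; adj = cycleAdj n }

hub : ∀ {n} → V (Wheel n)
hub = inj₂ tt

colourable-mono : ∀ {G j m} → j ≤ m → Colourable G j → Colourable G m
colourable-mono j≤m (f , proper) =
  (λ x → inject≤ (f x) j≤m) ,
  λ u v e eq → proper u v e (inject≤-injective j≤m j≤m (f u) (f v) eq)

¬colourable⇒< : ∀ {G m j} → ¬ Colourable G m → Colourable G j → m < j
¬colourable⇒< ¬col col = ≰⇒> (λ j≤m → ¬col (colourable-mono j≤m col))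

edge⇒¬1-colourable : ∀ {G} u v → Edge G u v → ¬ Colourable G 1
edge⇒¬1-colourable u v e (f , proper) with f u | f v | proper u v e
... | zero | zero | f≢ = f≢ refl

proper-avoiding⇒colourable : ∀ {G k} {c : Fin (suc k)} (f : Coloring G (suc k)) →
  IsProper G f → (∀ x → c ≢ f x) → Colourable G k
proper-avoiding⇒colourable f proper avoid =
  (λ x → punchOut (avoid x)) ,
  λ u v e eq → proper u v e (punchOut-injective (avoid u) (avoid v) eq)

module ShadowRecolouring (G : Graph) (undirected : Undirected G) {k : ℕ}
  (f : Coloring (Mycielskian G) k) (proper : IsProper (Mycielskian G) f) where

  d : Fin k
  d = f (inj₂ (inj₂ tt))

  unlessD : Fin k → Fin k → Fin k
  unlessD a b with a ≟ d
  ... | yes _ = b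
  ... | no _ = a

  unlessD≢d : ∀ a b → b ≢ d → unlessD a b ≢ d
  unlessD≢d a b b≢d with a ≟ d
  ... | yes _ = b≢d
  ... | no a≢d = a≢d

  unlessD-≢ : ∀ {a b a′ b′} → a ≢ a′ → a ≢ b′ → b ≢ a′ → unlessD a b ≢ unlessD a′ b′
  unlessD-≢ {a} {b} {a′} {b′} a≢a′ a≢b′ b≢a′ with a ≟ d | a′ ≟ d
  ... | yes a≡d | yes a′≡d = λ _ → a≢a′ (trans a≡d (sym a′≡d))
  ... | yes _   | no _     = b≢a′
  ... | no _    | yes _    = a≢b′
  ... | no _    | no _     = a≢a′

  g : Coloring G k
  g x = unlessD (f (inj₁ x)) (f (inj₂ (inj₁ x)))

  g-proper : IsProper G g
  g-proper x y e = unlessD-≢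
    (proper (inj₁ x) (inj₁ y) e)
    (proper (inj₁ x) (inj₂ (inj₁ y)) (undirected x y e))
    (proper (inj₂ (inj₁ x)) (inj₁ y) e)

  g-avoids-d : ∀ x → d ≢ g x
  g-avoids-d x = ≢-sym (unlessD≢d (f (inj₁ x)) _ (proper (inj₂ (inj₁ x)) (inj₂ (inj₂ tt)) refl))

mycielskian-colourable⇒colourable : ∀ {G k} → Undirected G →
  Colourable (Mycielskian G) (suc k) → Colourable G k
mycielskian-colourable⇒colourable {G} undirected (f , proper) =
  proper-avoiding⇒colourable g g-proper g-avoids-d
  where open ShadowRecolouring G undirected f proper

Successor : ℕ → ℕ → ℕ → Set
Successor n a b = suc a ≡ b ⊎ suc a ≡ n × b ≡ 0

succMod⇔successor : ∀ {n} (i j : Fin n) → T (succMod n i j) ⇔ Successor n (toℕ i) (toℕ j)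
succMod⇔successor {n} i j = mk⇔
  (Sum.map (≡ᵇ⇒≡ _ _) (Product.map (≡ᵇ⇒≡ _ _) (≡ᵇ⇒≡ _ _) ∘ Equivalence.to T-∧)
     ∘ Equivalence.to (T-∨ {suc (toℕ i) ≡ᵇ toℕ j}))
  (Equivalence.from (T-∨ {suc (toℕ i) ≡ᵇ toℕ j})
     ∘ Sum.map (≡⇒≡ᵇ _ _) (Equivalence.from T-∧ ∘ Product.map (≡⇒≡ᵇ _ _) (≡⇒≡ᵇ _ _)))

successor⇒cycle-edge : ∀ {n} {i j : Fin n} → Successor n (toℕ i) (toℕ j) → Edge (Cycle n) i j
successor⇒cycle-edge {n} {i} {j} s =
  Equivalence.to T-≡ (Equivalence.from (T-∨ {succMod n i j})
    (inj₁ (Equivalence.from (succMod⇔successor i j) s)))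

cycle-edge⇒successor : ∀ {n} {i j : Fin n} → Edge (Cycle n) i j →
  Successor n (toℕ i) (toℕ j) ⊎ Successor n (toℕ j) (toℕ i)
cycle-edge⇒successor {n} {i} {j} e =
  Sum.map (Equivalence.to (succMod⇔successor i j)) (Equivalence.to (succMod⇔successor j i))
    (Equivalence.to (T-∨ {succMod n i j}) (Equivalence.from T-≡ e))

wheel-undirected : ∀ n → Undirected (Wheel n)
wheel-undirected n (inj₁ i) (inj₁ j) e = trans (∨-comm (succMod n j i) (succMod n i j)) e
wheel-undirected n (inj₁ _) (inj₂ _) _ = refl
wheel-undirected n (inj₂ _) (inj₁ _) _ = refl

consecutive-edge : ∀ {m n} (p : m < n) (q : suc m < n) → Edge (Cycle n) (fromℕ< p) (fromℕ< q)
consecutive-edge p q = successor⇒cycle-edge (inj₁ (trans (cong suc (toℕ-fromℕ< p)) (sym (toℕ-fromℕ< q))))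

cycle-not-1-colourable : ∀ {n} → 2 ≤ n → ¬ Colourable (Cycle n) 1
cycle-not-1-colourable 2≤n =
  edge⇒¬1-colourable (fromℕ< (<⇒≤ 2≤n)) (fromℕ< 2≤n) (consecutive-edge (<⇒≤ 2≤n) 2≤n)

≢-≢⇒≡ : {a b c : Fin 2} → a ≢ b → b ≢ c → a ≡ c
≢-≢⇒≡ {zero}     {zero}     a≢b _   = contradiction refl a≢b
≢-≢⇒≡ {zero}     {suc zero} {zero}     _ _   = refl
≢-≢⇒≡ {zero}     {suc zero} {suc zero} _ b≢c = contradiction refl b≢c
≢-≢⇒≡ {suc zero} {suc zero} a≢b _   = contradiction refl a≢b
≢-≢⇒≡ {suc zero} {zero}     {suc zero} _ _   = refl
≢-≢⇒≡ {suc zero} {zero}     {zero}     _ b≢c = contradiction refl b≢c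

-- With two colours the colour alternates along the cycle, so the vertex 2t,
-- which closes the odd cycle, gets the colour of its neighbour 0.
oddCycle-not-2-colourable : ∀ t → ¬ Colourable (Cycle (suc (t * 2))) 2
oddCycle-not-2-colourable t (f , proper) =
  proper (fromℕ< last) zero (successor⇒cycle-edge (inj₂ (cong suc (toℕ-fromℕ< last) , refl)))
         (even-vertex t last)
  where
  last : t * 2 < suc (t * 2)
  last = n<1+n (t * 2)
  even-vertex : ∀ s (p : s * 2 < suc (t * 2)) → f (fromℕ< p) ≡ f zero
  even-vertex zero p = refl
  even-vertex (suc s) p = trans
    (≢-≢⇒≡ (≢-sym (proper (fromℕ< (<⇒≤ p)) (fromℕ< p) (consecutive-edge (<⇒≤ p) p)))
            (≢-sym (proper (fromℕ< (<⇒≤ (<⇒≤ p))) (fromℕ< (<⇒≤ p))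
                           (consecutive-edge (<⇒≤ (<⇒≤ p)) (<⇒≤ p)))))
    (even-vertex s (<⇒≤ (<⇒≤ p)))

wheel-colourable⇒cycle-colourable : ∀ {n k} → Colourable (Wheel n) (suc k) → Colourable (Cycle n) k
wheel-colourable⇒cycle-colourable (f , proper) =
  proper-avoiding⇒colourable (f ∘ inj₁) (λ i j → proper (inj₁ i) (inj₁ j))
    (λ i eq → proper (inj₁ i) hub refl (sym eq))

isTDC⇒colourable : ∀ {G k} {f : Coloring G k} → IsTDC G k f → Colourable G k
isTDC⇒colourable {f = f} tdc = f , proj₁ tdc

optimal-isChiDT : ∀ {G m} {f : Coloring G (suc m)} → ¬ Colourable G m → IsTDC G (suc m) f →
  IsChiDT G (suc m)
optimal-isChiDT ¬col tdc = (_ , tdc) , λ j g tdc′ → ¬colourable⇒< ¬col (isTDC⇒colourable tdc′)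

pnEmpty⇒dominates-other-class : ∀ {G k} {f : Coloring G k} {c : Fin k} →
  IsTDC G k f → PnEmpty G f c → ∀ x → ∃ λ i → i ≢ c × Dom G f x i
pnEmpty⇒dominates-other-class {c = c} (_ , _ , dominates) pn x with dominates x
... | i , x≻i with i ≟ c
...   | yes refl = pn x x≻i
...   | no i≢c = i , i≢c , x≻i

mycielskianColouring : ∀ {G k} → Coloring G k → Fin k → Coloring (Mycielskian G) (suc k)
mycielskianColouring f c (inj₁ x) = suc (f x)
mycielskianColouring f c (inj₂ (inj₁ _)) = zero
mycielskianColouring f c (inj₂ (inj₂ _)) = suc c

module _ {G : Graph} {k : ℕ} {f : Coloring G k} {c : Fin k} where

  private
    M : Graph
    M = Mycielskian G
    f′ : Coloring M (suc k)
    f′ = mycielskianColouring {G} f c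

  mycielskianColouring-proper : IsProper G f → IsProper M f′
  mycielskianColouring-proper proper (inj₁ x) (inj₁ y) e = proper x y e ∘ suc-injective
  mycielskianColouring-proper proper (inj₁ _) (inj₂ (inj₁ _)) _ ()
  mycielskianColouring-proper proper (inj₂ (inj₁ _)) (inj₁ _) _ ()
  mycielskianColouring-proper proper (inj₂ (inj₁ _)) (inj₂ (inj₂ _)) _ ()
  mycielskianColouring-proper proper (inj₂ (inj₂ _)) (inj₂ (inj₁ _)) _ ()

  dom-lift : ∀ {x i} (s : V M) → (∀ y → Edge G x y → Edge M s (inj₁ y)) →
    i ≢ c → Dom G f x i → Dom M f′ s (suc i)
  dom-lift s lift i≢c x≻i (inj₁ y) eq = lift y (x≻i y (suc-injective eq))
  dom-lift s lift i≢c x≻i (inj₂ (inj₂ _)) eq = contradiction (sym (suc-injective eq)) i≢c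

  w-dominates-shadows : Dom M f′ (inj₂ (inj₂ tt)) zero
  w-dominates-shadows (inj₂ (inj₁ _)) _ = refl

  mycielskian-isTDC : IsTDC G k f → PnEmpty G f c → IsTDC M (suc k) f′
  mycielskian-isTDC tdc@(proper , nonempty , _) pn =
    mycielskianColouring-proper proper , nonempty′ , dominates
    where
    nonempty′ : AllClassesNonempty M f′
    nonempty′ zero = inj₂ (inj₁ (proj₁ (nonempty c))) , refl
    nonempty′ (suc i) with nonempty i
    ... | x , fx≡i = inj₁ x , cong suc fx≡i
    dominates : ∀ s → ∃ λ i → Dom M f′ s i
    dominates (inj₁ x) with pnEmpty⇒dominates-other-class tdc pn x
    ... | i , i≢c , x≻i = suc i , dom-lift (inj₁ x) (λ _ e → e) i≢c x≻i
    dominates (inj₂ (inj₁ x)) with pnEmpty⇒dominates-other-class tdc pn x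
    ... | i , i≢c , x≻i = suc i , dom-lift (inj₂ (inj₁ x)) (λ _ e → e) i≢c x≻i
    dominates (inj₂ (inj₂ _)) = zero , w-dominates-shadows

record Class1Certificate (G : Graph) (m : ℕ) : Set where
  field
    not-colourable : ¬ Colourable G m
    colouring      : Coloring G (suc m)
    isTDC          : IsTDC G (suc m) colouring
    colour         : Fin (suc m)
    pnEmpty        : PnEmpty G colouring colour

module _ {G : Graph} {m : ℕ} (cert : Class1Certificate G m) where
  open Class1Certificate cert

  certificate⇒Class1 : Class1 G
  certificate⇒Class1 =
    suc m , optimal-isChiDT not-colourable isTDC , colouring , isTDC , colour , pnEmpty

  certificate⇒mycielskian-isChiDT : Undirected G → IsChiDT (Mycielskian G) (suc (suc m))
  certificate⇒mycielskian-isChiDT undirected = optimal-isChiDT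
    (not-colourable ∘ mycielskian-colourable⇒colourable undirected)
    (mycielskian-isTDC isTDC pnEmpty)

alternating : ∀ {k} → ℕ → Fin (3 + k)
alternating zero = zero
alternating (suc zero) = suc zero
alternating (suc (suc m)) = alternating m

alternating≢suc : ∀ {k} m → alternating {k} m ≢ alternating (suc m)
alternating≢suc zero ()
alternating≢suc (suc zero) ()
alternating≢suc (suc (suc m)) = alternating≢suc m

alternating≢2+ : ∀ {k} m {j} → alternating {k} m ≢ suc (suc j)
alternating≢2+ zero ()
alternating≢2+ (suc zero) ()
alternating≢2+ (suc (suc m)) = alternating≢2+ m

alternating-odd : ∀ {k} s → alternating {k} (suc (s * 2)) ≡ suc zero
alternating-odd zero = refl
alternating-odd (suc s) = alternating-odd s

cycleColour : ∀ {k} → Fin (3 + k) → ℕ → Fin (3 + k)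
cycleColour z zero = z
cycleColour z (suc m) = alternating (suc m)

wheelColouring : ∀ {n k} → Fin (3 + k) → Coloring (Wheel n) (3 + k)
wheelColouring z (inj₁ i) = cycleColour z (toℕ i)
wheelColouring z (inj₂ _) = suc (suc zero)

module _ {n k : ℕ} {z : Fin (3 + k)} (z≢2 : z ≢ suc (suc zero)) where

  cycleColour≢2 : ∀ m → cycleColour z m ≢ suc (suc zero)
  cycleColour≢2 zero = z≢2
  cycleColour≢2 (suc m) = alternating≢2+ (suc m)

  cycle-dominates-hub-class : ∀ i → Dom (Wheel n) (wheelColouring z) (inj₁ i) (suc (suc zero))
  cycle-dominates-hub-class i (inj₁ j) eq = contradiction eq (cycleColour≢2 (toℕ j))
  cycle-dominates-hub-class i (inj₂ _) _ = refl

  hub-dominates-class-1 : Dom (Wheel n) (wheelColouring z) hub (suc zero)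
  hub-dominates-class-1 (inj₁ _) _ = refl

  wheelColouring-pnEmpty : PnEmpty (Wheel n) (wheelColouring z) zero
  wheelColouring-pnEmpty (inj₁ i) _ = suc (suc zero) , (λ ()) , cycle-dominates-hub-class i
  wheelColouring-pnEmpty (inj₂ _) _ = suc zero , (λ ()) , hub-dominates-class-1

  module _ (z≢1 : z ≢ suc zero) (z≢last : z ≢ alternating (pred n)) where

    cycleColour-successor : 2 ≤ n → ∀ {a b} → Successor n a b → cycleColour z a ≢ cycleColour z b
    cycleColour-successor _ {zero} (inj₁ refl) = z≢1
    cycleColour-successor _ {suc a} (inj₁ refl) = alternating≢suc (suc a)
    cycleColour-successor (s≤s ()) {zero} (inj₂ (refl , _))
    cycleColour-successor _ {suc a} (inj₂ (refl , refl)) = ≢-sym z≢last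

    wheelColouring-proper : 2 ≤ n → IsProper (Wheel n) (wheelColouring z)
    wheelColouring-proper 2≤n (inj₁ i) (inj₁ j) e with cycle-edge⇒successor {i = i} {j} e
    ... | inj₁ i→j = cycleColour-successor 2≤n i→j
    ... | inj₂ j→i = ≢-sym (cycleColour-successor 2≤n j→i)
    wheelColouring-proper 2≤n (inj₁ i) (inj₂ _) _ = cycleColour≢2 (toℕ i)
    wheelColouring-proper 2≤n (inj₂ _) (inj₁ j) _ = ≢-sym (cycleColour≢2 (toℕ j))

    wheelColouring-isTDC : 3 ≤ n → (∀ j → suc (suc (suc j)) ≡ z) →
      IsTDC (Wheel n) (3 + k) (wheelColouring z)
    wheelColouring-isTDC 3≤n extra-colours =
      wheelColouring-proper (<⇒≤ 3≤n) , nonempty , dominates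
      where
      vertex : ∀ {m} → m < n → ∃ λ v → wheelColouring z v ≡ cycleColour z m
      vertex m<n = inj₁ (fromℕ< m<n) , cong (cycleColour z) (toℕ-fromℕ< m<n)
      nonempty : AllClassesNonempty (Wheel n) (wheelColouring z)
      nonempty zero = vertex 3≤n
      nonempty (suc zero) = vertex (<⇒≤ 3≤n)
      nonempty (suc (suc zero)) = hub , refl
      nonempty (suc (suc (suc j))) with vertex (<⇒≤ (<⇒≤ 3≤n))
      ... | v , eq = v , trans eq (sym (extra-colours j))
      dominates : ∀ v → ∃ λ i → Dom (Wheel n) (wheelColouring z) v i
      dominates (inj₁ i) = _ , cycle-dominates-hub-class i
      dominates (inj₂ _) = _ , hub-dominates-class-1

wheel-certificate-even : ∀ t → 3 ≤ t * 2 → Class1Certificate (Wheel (t * 2)) 2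
wheel-certificate-even (suc s) 3≤n = record
  { not-colourable = cycle-not-1-colourable (<⇒≤ 3≤n) ∘ wheel-colourable⇒cycle-colourable
  ; colouring      = wheelColouring zero
  ; isTDC          = wheelColouring-isTDC (λ ()) (λ ()) 0≢last 3≤n (λ ())
  ; colour         = zero
  ; pnEmpty        = wheelColouring-pnEmpty (λ ())
  }
  where
  0≢last : zero ≢ alternating (suc (s * 2))
  0≢last eq with trans eq (alternating-odd s)
  ... | ()

wheel-certificate-odd : ∀ t → 3 ≤ suc (t * 2) → Class1Certificate (Wheel (suc (t * 2))) 3
wheel-certificate-odd t 3≤n = record
  { not-colourable = oddCycle-not-2-colourable t ∘ wheel-colourable⇒cycle-colourable
  ; colouring      = wheelColouring (suc (suc (suc zero)))
  ; isTDC          = wheelColouring-isTDC (λ ()) (λ ()) (≢-sym (alternating≢2+ (t * 2))) 3≤n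
                       λ { zero → refl }
  ; colour         = zero
  ; pnEmpty        = wheelColouring-pnEmpty (λ ())
  }

data Parity : ℕ → Set where
  even : ∀ t → Parity (t * 2)
  odd  : ∀ t → Parity (suc (t * 2))

parity : ∀ n → Parity n
parity zero = even zero
parity (suc n) with parity n
... | even t = odd t
... | odd t = even (suc t)

proposition3p1 : (n : ℕ) → 3 ≤ n →
    Class1 (Wheel n)
    × (n % 2 ≡ 0 → IsChiDT (Mycielskian (Wheel n)) 4)
    × (n % 2 ≡ 1 → IsChiDT (Mycielskian (Wheel n)) 5)
proposition3p1 n 3≤n with parity n
... | even t =
  certificate⇒Class1 cert ,
  (λ _ → certificate⇒mycielskian-isChiDT cert (wheel-undirected n)) ,
  (λ n%2≡1 → contradiction (trans (sym (m*n%n≡0 t 2)) n%2≡1) λ ())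
  where cert = wheel-certificate-even t 3≤n
... | odd t =
  certificate⇒Class1 cert ,
  (λ n%2≡0 → contradiction (trans (sym ([m+kn]%n≡m%n 1 t 2)) n%2≡0) λ ()) ,
  (λ _ → certificate⇒mycielskian-isChiDT cert (wheel-undirected n))
  where cert = wheel-certificate-odd t 3≤n
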